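{- A standard system is complete if and only if it contains the system $\mathbf{Mp}$.
   Context: Formulas are built from literals, namely propositional variables $P,Q,\dots$ and their formal complements $\bar P,\bar Q,\dots$, using the binary connectives $\wedge$ and $\vee$. Negation $\neg$ is an operation on formulas, not a connective: $\neg P=\bar P$, $\neg\bar P=P$, $\neg(A\wedge B)=\neg A\vee\neg B$, $\neg(A\vee B)=\neg A\wedge\neg B$. A sequent is a nonempty finite multiset (disjoint union) of formulas. A comma denotes multiset union, and $\Gamma,\Delta,\Sigma$ range over possibly empty finite multisets of formulas. A formula is valid if it evaluates to $1$ under every $0/1$-assignment to its variables, with $\bar P$ read as the complement of $P$. Rules: - Axiom: infer $P,\neg P$ from no premises, for any propositional variable $P$. - $(\&)$: from $\Gamma,A$ and $\Gamma,B$ infer $\Gamma,A\wedge B$. - $(\otimes)$: from $\Delta,A$ and $\Sigma,B$ infer $\Delta,\Sigma,A\wedge B$. - Blended $(\wedge)$: from $\Gamma,\Delta,A$ and $\Gamma,\Sigma,B$ infer $\Gamma,\Delta,\Sigma,A\wedge B$. - $(\oplus)$: consists of both $(\oplus_1)$ and $(\oplus_2)$, where $(\oplus_i)$ infers $\Gamma,A_1\vee A_2$ from $\Gamma,A_i$. - $(\mathrm{par})$: from $\Gamma,A,B$ infer $\Gamma,A\vee B$. - Weakening $(\mathsf W)$: from $\Gamma$ infer $\Gamma,A$. - Contraction $(\mathsf C)$: from $\Gamma,A,A$ infer $\Gamma,A$. A system consists of the axiom together with a set of these rules. Derivations are finite trees of rule instances. A standard system is the axiom together with any subset of $\{(\&),(\otimes),(\oplus),(\mathrm{par}),(\mathsf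 W),(\mathsf C)\}$. The system $\mathbf{Mp}$ is the axiom together with $(\wedge),(\oplus),(\mathrm{par})$. A rule is derivable in a system $S$ if, for every instance of the rule, its conclusion can be derived in $S$ from its premises used as additional leaves. $S$ contains $T$ if every rule of $T$ is derivable in $S$. A system is complete if every valid formula, viewed as a one-element sequent, is derivable in it. -}

module Defs where

open import Data.Nat using (ℕ)
open import Data.Bool using (Bool; true; false; not) renaming (_∧_ to _and_; _∨_ to _or_)
open import Data.List using (List; []; _∷_; _++_; [_])
open import Data.List.Membership.Propositional using (_∈_)
open import Data.List.Relation.Unary.All using (All)
open import Data.List.Relation.Binary.Permutation.Propositional using (_↭_)
open import Data.Product using (_×_)
open import Relation.Binary.PropositionalEquality using (_≡_; _≢_)

infixr 6 _∧_
infixr 5 _∨_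

data Fm : Set where
  pos neg : ℕ → Fm
  _∧_ _∨_ : Fm → Fm → Fm

¬f : Fm → Fm
¬f (pos P) = neg P
¬f (neg P) = pos P
¬f (A ∧ B) = ¬f A ∨ ¬f B
¬f (A ∨ B) = ¬f A ∧ ¬f B

eval : (ℕ → Bool) → Fm → Bool
eval v (pos P) = v P
eval v (neg P) = not (v P)
eval v (A ∧ B) = eval v A and eval v B
eval v (A ∨ B) = eval v A or eval v B

Valid : Fm → Set
Valid A = ∀ (v : ℕ → Bool) → eval v A ≡ true

-- Sequents: finite multisets of formulas, represented as lists taken
-- up to permutation (derivations are closed under _↭_).
Seq : Set
Seq = List Fm

data Rule : Set where
  with-r tensor-r blended-r plus-r par-r weak-r contr-r : Rule

data Inst : Rule → List Seq → Seq → Set where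
  with-i    : ∀ Γ A B → Inst with-r ((Γ ++ [ A ]) ∷ (Γ ++ [ B ]) ∷ []) (Γ ++ [ A ∧ B ])
  tensor-i  : ∀ Δ Σ A B → Inst tensor-r ((Δ ++ [ A ]) ∷ (Σ ++ [ B ]) ∷ []) (Δ ++ Σ ++ [ A ∧ B ])
  blended-i : ∀ Γ Δ Σ A B →
              Inst blended-r ((Γ ++ Δ ++ [ A ]) ∷ (Γ ++ Σ ++ [ B ]) ∷ []) (Γ ++ Δ ++ Σ ++ [ A ∧ B ])
  plus₁-i   : ∀ Γ A B → Inst plus-r ((Γ ++ [ A ]) ∷ []) (Γ ++ [ A ∨ B ])
  plus₂-i   : ∀ Γ A B → Inst plus-r ((Γ ++ [ B ]) ∷ []) (Γ ++ [ A ∨ B ])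
  par-i     : ∀ Γ A B → Inst par-r ((Γ ++ A ∷ B ∷ []) ∷ []) (Γ ++ [ A ∨ B ])
  -- sequents are nonempty, so the premise Γ of weakening is nonempty
  weak-i    : ∀ Γ A → Γ ≢ [] → Inst weak-r (Γ ∷ []) (Γ ++ [ A ])
  contr-i   : ∀ Γ A → Inst contr-r ((Γ ++ A ∷ A ∷ []) ∷ []) (Γ ++ [ A ])

-- A system: the axiom together with the set of rules r with S r ≡ true.
System : Set
System = Rule → Bool

data Der (S : System) (H : List Seq) : Seq → Set where
  hyp  : ∀ {Γ} → Γ ∈ H → Der S H Γ
  ax   : ∀ P → Der S H (pos P ∷ ¬f (pos P) ∷ [])
  rule : ∀ {r ps c} → S r ≡ true → Inst r ps c → All (Der S H) ps → Der S H c
  perm : ∀ {Γ Δ} → Der S H Γ → Γ ↭ Δ → Der S H Δ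

DerivableRule : System → Rule → Set
DerivableRule S r = ∀ ps c → Inst r ps c → Der S ps c

Contains : System → System → Set
Contains S T = ∀ r → T r ≡ true → DerivableRule S r

Complete : System → Set
Complete S = ∀ A → Valid A → Der S [] [ A ]

-- Standard systems: any subset of {&, ⊗, ⊕, par, W, C} (no blended ∧).
Standard : System → Set
Standard S = S blended-r ≡ false

Mp : System
Mp blended-r = true
Mp plus-r    = true
Mp par-r     = true
Mp _         = false

module Submission where

-- Mp is complete: a proof search decomposes the formulas of a valid sequent and keeps a
-- derivable sub-multiset at every step (Mp has no weakening); at a conjunction the two
-- sub-multisets obtained for the premises are merged by the blended rule. Conversely a complete
-- standard system S derives the rules of Mp: ⊕ from par and W, par from ⊕ and C, blended ∧ from
-- & and W or from ⊗ and C. If S lacks what one of these needs, it is contained in one of seven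
-- maximal standard systems, each of which has a model refuting some valid formula: a
-- commutative monoid of sequent values whose designated elements are preserved by its rules.

open import Defs
open import Data.Bool using (Bool; true; false; T; not; if_then_else_) renaming (_∧_ to _and_; _∨_ to _or_)
open import Data.Bool.Properties using (T?; T-∧; T-∨; T-≡; ∨-assoc; ∨-comm; ∨-identityˡ) renaming (_≟_ to _≟ᵇ_)
open import Data.Empty using (⊥-elim)
open import Data.Fin using (Fin; zero; suc)
open import Data.Fin.Properties using () renaming (_≟_ to _≟ᶠ_)
open import Data.List using (List; []; _∷_; _++_; [_]; map; filter; foldr; allFin; cartesianProduct)
open import Data.List.Properties using (++-conicalʳ; ++-assoc; ++-identityʳ)
open import Data.List.Membership.Propositional using (_∈_; find)
open import Data.List.Membership.Propositional.Properties using (∈-map⁺; ∈-filter⁺; ∈-allFin; ∈-cartesianProduct⁺)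
open import Data.List.Relation.Unary.All as All using (All; []; _∷_)
open import Data.List.Relation.Unary.Any as Any using (Any; here; there)
open import Data.List.Relation.Binary.Sublist.Propositional using (_⊆_; []; _∷_; _∷ʳ_; from∈)
open import Data.List.Relation.Binary.Permutation.Propositional
open import Data.List.Relation.Binary.Permutation.Propositional.Properties
  using (++-commutativeMonoid; ++-comm; map⁺; Any-resp-↭; ↭-empty-inv)
open import Data.Nat using (ℕ; suc; _+_; _*_; _<_; NonZero; s≤s)
open import Data.Nat.DivMod using (_/_; m*n/n≡m)
open import Data.Nat.Divisibility using (_∣?_; n∣m*n)
open import Data.Nat.Induction using (<-wellFounded)
open import Data.Nat.ListAction using (sum)
open import Data.Nat.ListAction.Properties using (sum-↭)
open import Data.Nat.Properties
  using (_≟_; ≤-reflexive; +-assoc; +-monoˡ-≤; m≤m+n; m≤n+m; <-≤-trans; *-assoc; *-comm; *-identityˡ; *-zeroʳ)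
open import Data.List.Membership.DecPropositional _≟_ using (_∈?_)
open import Data.Product using (∃-syntax; _×_; _,_; proj₁; proj₂)
open import Data.Product.Properties using (≡-dec)
open import Data.Sum using (_⊎_; inj₁; inj₂; [_,_]′)
open import Data.Unit using (⊤; tt)
open import Function using (id; _∘_; case_of_)
open import Function.Bundles using (Equivalence)
open import Induction.WellFounded using (Acc; acc)
open import Relation.Nullary using (Dec; yes; no; isYes; map′; ¬_)
open import Relation.Nullary.Decidable using (True; from-yes; toWitness; _×-dec_; _→-dec_)
open import Relation.Binary.Definitions using (DecidableEquality)
open import Relation.Binary.PropositionalEquality using (_≡_; _≢_; refl; sym; cong; subst) renaming (trans to ≡-trans)
import Algebra.Solver.CommutativeMonoid as CommutativeMonoidSolver

open CommutativeMonoidSolver (++-commutativeMonoid {A = Fm}) using (solve; _⊕_; _⊜_)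

mutual
  graft : ∀ {S H ps Γ} → Der S ps Γ → All (Der S H) ps → Der S H Γ
  graft (hyp Γ∈ps)   ds = All.lookup ds Γ∈ps
  graft (ax P)       ds = ax P
  graft (rule e i d) ds = rule e i (graft-all d ds)
  graft (perm d p)   ds = perm (graft d ds) p

  graft-all : ∀ {S H ps Γs} → All (Der S ps) Γs → All (Der S H) ps → All (Der S H) Γs
  graft-all []       ds = []
  graft-all (d ∷ es) ds = graft d ds ∷ graft-all es ds

module _ {S T : System} (S⊇T : Contains S T) where

  mutual
    Contains⇒Der : ∀ {H Γ} → Der T H Γ → Der S H Γ
    Contains⇒Der (hyp Γ∈H)                  = hyp Γ∈H
    Contains⇒Der (ax P)                     = ax P
    Contains⇒Der (rule {r} {ps} {c} e i ds) = graft (S⊇T r e ps c i) (Contains⇒Der-all ds)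
    Contains⇒Der (perm d p)                 = perm (Contains⇒Der d) p

    Contains⇒Der-all : ∀ {H Γs} → All (Der T H) Γs → All (Der S H) Γs
    Contains⇒Der-all []       = []
    Contains⇒Der-all (d ∷ ds) = Contains⇒Der d ∷ Contains⇒Der-all ds

  Contains⇒Complete : Complete T → Complete S
  Contains⇒Complete complete A valid = Contains⇒Der (complete A valid)

++≢[] : ∀ Γ {Δ : List Fm} → Δ ≢ [] → Γ ++ Δ ≢ []
++≢[] Γ Δ≢[] = Δ≢[] ∘ ++-conicalʳ Γ _

conclusion≢[] : ∀ {r ps c} → Inst r ps c → c ≢ []
conclusion≢[] (with-i Γ _ _)        = ++≢[] Γ λ ()
conclusion≢[] (tensor-i Δ Σ _ _)    = ++≢[] Δ (++≢[] Σ λ ())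
conclusion≢[] (blended-i Γ Δ Σ _ _) = ++≢[] Γ (++≢[] Δ (++≢[] Σ λ ()))
conclusion≢[] (plus₁-i Γ _ _)       = ++≢[] Γ λ ()
conclusion≢[] (plus₂-i Γ _ _)       = ++≢[] Γ λ ()
conclusion≢[] (par-i Γ _ _)         = ++≢[] Γ λ ()
conclusion≢[] (weak-i Γ _ _)        = ++≢[] Γ λ ()
conclusion≢[] (contr-i Γ _)         = ++≢[] Γ λ ()

derivable≢[] : ∀ {S Γ} → Der S [] Γ → Γ ≢ []
derivable≢[] (ax P) ()
derivable≢[] (rule _ i _) = conclusion≢[] i
derivable≢[] (perm d p) refl = derivable≢[] d (↭-empty-inv p)

-- Completeness of Mp

Holds : (ℕ → Bool) → Fm → Set
Holds v A = T (eval v A)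

ValidSeq : List Fm → Set
ValidSeq Γ = ∀ v → Any (Holds v) Γ

connectives : Fm → ℕ
connectives (pos _) = 0
connectives (neg _) = 0
connectives (A ∧ B) = suc (connectives A + connectives B)
connectives (A ∨ B) = suc (connectives A + connectives B)

size : List Fm → ℕ
size = sum ∘ map connectives

size-↭ : ∀ {Γ Δ} → Γ ↭ Δ → size Γ ≡ size Δ
size-↭ = sum-↭ ∘ map⁺ connectives

data Literal : Fm → Set where
  positive : ∀ P → Literal (pos P)
  negative : ∀ P → Literal (neg P)

data Shape (Γ : List Fm) : Set where
  literals : All Literal Γ → Shape Γ
  disj : ∀ {A B Δ} → Γ ↭ (A ∨ B) ∷ Δ → Shape Γ
  conj : ∀ {A B Δ} → Γ ↭ (A ∧ B) ∷ Δ → Shape Γ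

shape-∷ : ∀ {L Γ} → Literal L → Shape Γ → Shape (L ∷ Γ)
shape-∷ l (literals ls) = literals (l ∷ ls)
shape-∷ _ (disj p)      = disj (trans (prep _ p) (swap _ _ refl))
shape-∷ _ (conj p)      = conj (trans (prep _ p) (swap _ _ refl))

shape : ∀ Γ → Shape Γ
shape []            = literals []
shape (pos P ∷ Γ)   = shape-∷ (positive P) (shape Γ)
shape (neg P ∷ Γ)   = shape-∷ (negative P) (shape Γ)
shape ((A ∧ B) ∷ Γ) = conj refl
shape ((A ∨ B) ∷ Γ) = disj refl

neg≟ : ∀ P L → Dec (neg P ≡ L)
neg≟ P (neg Q) = map′ (cong neg) (λ { refl → refl }) (P ≟ Q)
neg≟ P (pos _) = no λ ()
neg≟ P (_ ∧ _) = no λ ()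
neg≟ P (_ ∨ _) = no λ ()

neg∈? : ∀ P Γ → Dec (neg P ∈ Γ)
neg∈? P = Any.any? (neg≟ P)

-- Make true exactly the variables occurring negatively in Γ; a true literal of Γ must be positive.
complementary-pair : ∀ {Γ} → All Literal Γ → ValidSeq Γ → ∃[ P ] pos P ∈ Γ × neg P ∈ Γ
complementary-pair {Γ} lits valid with find (valid λ P → isYes (neg∈? P Γ))
... | L , L∈Γ , holds with All.lookup lits L∈Γ
...   | positive P = P , L∈Γ , toWitness {a? = neg∈? P Γ} holds
...   | negative P with neg∈? P Γ
...     | yes _     = ⊥-elim holds
...     | no P∉Γ    = ⊥-elim (P∉Γ L∈Γ)

pos-neg⊆ : ∀ {P Γ} → pos P ∈ Γ → neg P ∈ Γ → ∃[ X ] X ⊆ Γ × X ↭ pos P ∷ neg P ∷ []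
pos-neg⊆ (here refl) (here ())
pos-neg⊆ (here refl) (there n) = _ , refl ∷ from∈ n , refl
pos-neg⊆ (there p) (here refl) = _ , refl ∷ from∈ p , swap _ _ refl
pos-neg⊆ (there p) (there n) with pos-neg⊆ p n
... | X , τ , σ = X , _ ∷ʳ τ , σ

⊆-↭ : ∀ {X Γ Δ : List Fm} → X ⊆ Γ → Γ ↭ Δ → ∃[ Y ] Y ⊆ Δ × X ↭ Y
⊆-↭ τ refl = _ , τ , refl
⊆-↭ (refl ∷ τ) (prep x p) with ⊆-↭ τ p
... | Y , σ , q = x ∷ Y , refl ∷ σ , prep x q
⊆-↭ (x ∷ʳ τ) (prep x p) with ⊆-↭ τ p
... | Y , σ , q = Y , x ∷ʳ σ , q
⊆-↭ (refl ∷ refl ∷ τ) (swap x y p) with ⊆-↭ τ p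
... | Y , σ , q = y ∷ x ∷ Y , refl ∷ refl ∷ σ , swap x y q
⊆-↭ (refl ∷ y ∷ʳ τ) (swap x y p) with ⊆-↭ τ p
... | Y , σ , q = x ∷ Y , y ∷ʳ refl ∷ σ , prep x q
⊆-↭ (x ∷ʳ refl ∷ τ) (swap x y p) with ⊆-↭ τ p
... | Y , σ , q = y ∷ Y , refl ∷ x ∷ʳ σ , prep y q
⊆-↭ (x ∷ʳ y ∷ʳ τ) (swap x y p) with ⊆-↭ τ p
... | Y , σ , q = Y , y ∷ʳ x ∷ʳ σ , q
⊆-↭ τ (trans p q) with ⊆-↭ τ p
... | Y , σ , r with ⊆-↭ σ q
...   | Z , ρ , s = Z , ρ , trans r s

DerivablePart : List Fm → Set
DerivablePart Γ = ∃[ X ] X ⊆ Γ × Der Mp [] X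

DerivablePart-↭ : ∀ {Γ Δ} → Γ ↭ Δ → DerivablePart Γ → DerivablePart Δ
DerivablePart-↭ p (X , τ , d) with ⊆-↭ τ p
... | Y , σ , q = Y , σ , perm d q

record Union (Γ X₁ X₂ : List Fm) : Set where
  field
    common only₁ only₂ : List Fm
    union : List Fm
    union⊆ : union ⊆ Γ
    split₁ : X₁ ↭ common ++ only₁
    split₂ : X₂ ↭ common ++ only₂
    split  : union ↭ common ++ only₁ ++ only₂

⊆-union : ∀ {Γ X₁ X₂} → X₁ ⊆ Γ → X₂ ⊆ Γ → Union Γ X₁ X₂
⊆-union [] [] = record
  { common = [] ; only₁ = [] ; only₂ = [] ; union = [] ; union⊆ = [] ; split₁ = refl ; split₂ = refl ; split = refl }
⊆-union {x ∷ _} (refl ∷ τ₁) (refl ∷ τ₂) = record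
  { common = x ∷ common ; only₁ = only₁ ; only₂ = only₂ ; union = x ∷ union ; union⊆ = refl ∷ union⊆
  ; split₁ = prep x split₁ ; split₂ = prep x split₂ ; split = prep x split }
  where open Union (⊆-union τ₁ τ₂)
⊆-union {x ∷ _} (refl ∷ τ₁) (x ∷ʳ τ₂) = record
  { common = common ; only₁ = x ∷ only₁ ; only₂ = only₂ ; union = x ∷ union ; union⊆ = refl ∷ union⊆
  ; split₁ = trans (prep x split₁) (solve 3 (λ x Z D → x ⊕ (Z ⊕ D) ⊜ Z ⊕ (x ⊕ D)) refl [ x ] common only₁)
  ; split₂ = split₂
  ; split = trans (prep x split)
                  (solve 4 (λ x Z D E → x ⊕ (Z ⊕ (D ⊕ E)) ⊜ Z ⊕ ((x ⊕ D) ⊕ E)) refl [ x ] common only₁ only₂) }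
  where open Union (⊆-union τ₁ τ₂)
⊆-union {x ∷ _} (x ∷ʳ τ₁) (refl ∷ τ₂) = record
  { common = common ; only₁ = only₁ ; only₂ = x ∷ only₂ ; union = x ∷ union ; union⊆ = refl ∷ union⊆
  ; split₁ = split₁
  ; split₂ = trans (prep x split₂) (solve 3 (λ x Z E → x ⊕ (Z ⊕ E) ⊜ Z ⊕ (x ⊕ E)) refl [ x ] common only₂)
  ; split = trans (prep x split)
                  (solve 4 (λ x Z D E → x ⊕ (Z ⊕ (D ⊕ E)) ⊜ Z ⊕ (D ⊕ (x ⊕ E))) refl [ x ] common only₁ only₂) }
  where open Union (⊆-union τ₁ τ₂)
⊆-union {x ∷ _} (x ∷ʳ τ₁) (x ∷ʳ τ₂) = record { Union (⊆-union τ₁ τ₂) ; union⊆ = x ∷ʳ union⊆ }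
  where open Union (⊆-union τ₁ τ₂)

module _ {S : System} {H : List Seq} {A B : Fm} where

  par-front : ∀ {Γ} → S par-r ≡ true → Der S H (A ∷ B ∷ Γ) → Der S H ((A ∨ B) ∷ Γ)
  par-front {Γ} e d =
    perm (rule e (par-i Γ A B) (perm d (++-comm (A ∷ B ∷ []) Γ) ∷ [])) (++-comm Γ [ A ∨ B ])

  plus₁-front : ∀ {Γ} → S plus-r ≡ true → Der S H (A ∷ Γ) → Der S H ((A ∨ B) ∷ Γ)
  plus₁-front {Γ} e d = perm (rule e (plus₁-i Γ A B) (perm d (++-comm [ A ] Γ) ∷ [])) (++-comm Γ [ A ∨ B ])

  plus₂-front : ∀ {Γ} → S plus-r ≡ true → Der S H (B ∷ Γ) → Der S H ((A ∨ B) ∷ Γ)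
  plus₂-front {Γ} e d = perm (rule e (plus₂-i Γ A B) (perm d (++-comm [ B ] Γ) ∷ [])) (++-comm Γ [ A ∨ B ])

  blended-front : ∀ {Γ Δ Σ} → S blended-r ≡ true →
                  Der S H (A ∷ Γ ++ Δ) → Der S H (B ∷ Γ ++ Σ) → Der S H ((A ∧ B) ∷ Γ ++ Δ ++ Σ)
  blended-front {Γ} {Δ} {Σ} e d₁ d₂ =
    perm (rule e (blended-i Γ Δ Σ A B) (perm d₁ (to-back Δ A) ∷ perm d₂ (to-back Σ B) ∷ []))
         (solve 4 (λ Γ Δ Σ C → Γ ⊕ (Δ ⊕ (Σ ⊕ C)) ⊜ C ⊕ (Γ ⊕ (Δ ⊕ Σ))) refl Γ Δ Σ [ A ∧ B ])
    where
    to-back : ∀ Δ C → C ∷ Γ ++ Δ ↭ Γ ++ Δ ++ [ C ]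
    to-back Δ C = solve 3 (λ C Γ Δ → C ⊕ (Γ ⊕ Δ) ⊜ Γ ⊕ (Δ ⊕ C)) refl [ C ] Γ Δ

∨-part : ∀ {A B Δ} → DerivablePart (A ∷ B ∷ Δ) → DerivablePart ((A ∨ B) ∷ Δ)
∨-part (_ , refl ∷ refl ∷ τ , d) = _ , refl ∷ τ , par-front refl d
∨-part (_ , refl ∷ _ ∷ʳ τ , d)   = _ , refl ∷ τ , plus₁-front refl d
∨-part (_ , _ ∷ʳ refl ∷ τ , d)   = _ , refl ∷ τ , plus₂-front refl d
∨-part (X , _ ∷ʳ _ ∷ʳ τ , d)     = X , _ ∷ʳ τ , d

∧-part : ∀ {A B Δ} → DerivablePart (A ∷ Δ) → DerivablePart (B ∷ Δ) → DerivablePart ((A ∧ B) ∷ Δ)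
∧-part (X , _ ∷ʳ τ , d) _ = X , _ ∷ʳ τ , d
∧-part _ (X , _ ∷ʳ τ , d) = X , _ ∷ʳ τ , d
∧-part (_ , refl ∷ τ₁ , d₁) (_ , refl ∷ τ₂ , d₂) =
  _ , refl ∷ union⊆ ,
  perm (blended-front {Γ = common} refl (perm d₁ (prep _ split₁)) (perm d₂ (prep _ split₂))) (prep _ (↭-sym split))
  where open Union (⊆-union τ₁ τ₂)

∨-valid : ∀ {A B Δ} → ValidSeq ((A ∨ B) ∷ Δ) → ValidSeq (A ∷ B ∷ Δ)
∨-valid valid v with valid v
... | here h  = [ here , there ∘ here ]′ (Equivalence.to T-∨ h)
... | there h = there (there h)

∧-valid : ∀ {A B Δ} → ValidSeq ((A ∧ B) ∷ Δ) → ValidSeq (A ∷ Δ) × ValidSeq (B ∷ Δ)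
∧-valid {A} {B} {Δ} valid = (λ v → left (valid v)) , (λ v → right (valid v))
  where
  left : ∀ {v} → Any (Holds v) ((A ∧ B) ∷ Δ) → Any (Holds v) (A ∷ Δ)
  left (here h)  = here (proj₁ (Equivalence.to T-∧ h))
  left (there h) = there h
  right : ∀ {v} → Any (Holds v) ((A ∧ B) ∷ Δ) → Any (Holds v) (B ∷ Δ)
  right (here h)  = here (proj₂ (Equivalence.to T-∧ h))
  right (there h) = there h

∨-smaller : ∀ A B Δ → size (A ∷ B ∷ Δ) < size ((A ∨ B) ∷ Δ)
∨-smaller A B Δ = s≤s (≤-reflexive (sym (+-assoc (connectives A) (connectives B) (size Δ))))

∧-smallerˡ : ∀ A B Δ → size (A ∷ Δ) < size ((A ∧ B) ∷ Δ)
∧-smallerˡ A B Δ = s≤s (+-monoˡ-≤ (size Δ) (m≤m+n (connectives A) (connectives B)))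

∧-smallerʳ : ∀ A B Δ → size (B ∷ Δ) < size ((A ∧ B) ∷ Δ)
∧-smallerʳ A B Δ = s≤s (+-monoˡ-≤ (size Δ) (m≤n+m (connectives B) (connectives A)))

search : ∀ Γ → Acc _<_ (size Γ) → ValidSeq Γ → DerivablePart Γ
search Γ _ valid with shape Γ
... | literals lits with complementary-pair lits valid
...   | P , p∈Γ , n∈Γ with pos-neg⊆ p∈Γ n∈Γ
...     | X , τ , σ = X , τ , perm (ax P) (↭-sym σ)
search Γ (acc rec) valid | disj {A} {B} {Δ} p =
  DerivablePart-↭ (↭-sym p) (∨-part (search (A ∷ B ∷ Δ) (rec smaller) (∨-valid valid′)))
  where
  valid′ : ValidSeq ((A ∨ B) ∷ Δ)
  valid′ v = Any-resp-↭ p (valid v)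
  smaller : size (A ∷ B ∷ Δ) < size Γ
  smaller = <-≤-trans (∨-smaller A B Δ) (≤-reflexive (sym (size-↭ p)))
search Γ (acc rec) valid | conj {A} {B} {Δ} p =
  DerivablePart-↭ (↭-sym p)
    (∧-part (search (A ∷ Δ) (rec smallerˡ) (proj₁ (∧-valid valid′)))
            (search (B ∷ Δ) (rec smallerʳ) (proj₂ (∧-valid valid′))))
  where
  valid′ : ValidSeq ((A ∧ B) ∷ Δ)
  valid′ v = Any-resp-↭ p (valid v)
  smallerˡ : size (A ∷ Δ) < size Γ
  smallerˡ = <-≤-trans (∧-smallerˡ A B Δ) (≤-reflexive (sym (size-↭ p)))
  smallerʳ : size (B ∷ Δ) < size Γ
  smallerʳ = <-≤-trans (∧-smallerʳ A B Δ) (≤-reflexive (sym (size-↭ p)))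

Mp-complete : Complete Mp
Mp-complete A valid with search [ A ] (<-wellFounded _) (λ v → here (Equivalence.from T-≡ (valid v)))
... | _ , refl ∷ [] , d = d
... | _ , _ ∷ʳ [] , d  = ⊥-elim (derivable≢[] d refl)

-- Derivable rules

rule⇒derivable : ∀ {S r} → S r ≡ true → DerivableRule S r
rule⇒derivable e ps c i = rule e i (All.tabulate hyp)

module _ {S : System} {H : List Seq} where

  weaken-by : S weak-r ≡ true → ∀ Σ {Γ} → Γ ≢ [] → Der S H Γ → Der S H (Γ ++ Σ)
  weaken-by e []      {Γ} _    d = perm d (↭-reflexive (sym (++-identityʳ Γ)))
  weaken-by e (A ∷ Σ) {Γ} Γ≢[] d =
    perm (weaken-by e Σ (++≢[] Γ λ ()) (rule e (weak-i Γ A Γ≢[]) (d ∷ []))) (↭-reflexive (++-assoc Γ [ A ] Σ))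

  contract-copy : S contr-r ≡ true → ∀ Γ {Δ} → Der S H (Γ ++ Γ ++ Δ) → Der S H (Γ ++ Δ)
  contract-copy e []      d = d
  contract-copy e (A ∷ Γ) {Δ} d =
    perm (contract-copy e Γ
           (perm contracted (solve 3 (λ Γ A Δ → (Γ ⊕ (Γ ⊕ Δ)) ⊕ A ⊜ Γ ⊕ (Γ ⊕ (A ⊕ Δ))) refl Γ [ A ] Δ)))
         (solve 3 (λ Γ A Δ → Γ ⊕ (A ⊕ Δ) ⊜ A ⊕ (Γ ⊕ Δ)) refl Γ [ A ] Δ)
    where
    contracted : Der S H ((Γ ++ Γ ++ Δ) ++ [ A ])
    contracted = rule e (contr-i (Γ ++ Γ ++ Δ) A)
      (perm d (solve 3 (λ A Γ Δ → A ⊕ (Γ ⊕ (A ⊕ (Γ ⊕ Δ))) ⊜ (Γ ⊕ (Γ ⊕ Δ)) ⊕ (A ⊕ A)) refl [ A ] Γ Δ) ∷ [])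

module _ {S : System} where

  par+weak⇒plus : S par-r ≡ true → S weak-r ≡ true → DerivableRule S plus-r
  par+weak⇒plus p w ps _ (plus₁-i Γ A B) =
    rule p (par-i Γ A B)
      (perm (weaken-by w [ B ] (++≢[] Γ λ ()) (hyp (here refl))) (↭-reflexive (++-assoc Γ [ A ] [ B ])) ∷ [])
  par+weak⇒plus p w ps _ (plus₂-i Γ A B) =
    rule p (par-i Γ A B)
      (perm (weaken-by w [ A ] (++≢[] Γ λ ()) (hyp (here refl)))
            (solve 3 (λ Γ A B → (Γ ⊕ B) ⊕ A ⊜ Γ ⊕ (A ⊕ B)) refl Γ [ A ] [ B ]) ∷ [])

  plus+contr⇒par : S plus-r ≡ true → S contr-r ≡ true → DerivableRule S par-r
  plus+contr⇒par p c ps _ (par-i Γ A B) = rule c (contr-i Γ (A ∨ B)) (perm twice (++-comm (_ ∷ _ ∷ []) Γ) ∷ [])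
    where
    twice : Der S ps ((A ∨ B) ∷ (A ∨ B) ∷ Γ)
    twice = plus₂-front p (perm (plus₁-front p (perm (hyp (here refl)) (++-comm Γ (A ∷ B ∷ [])))) (swap _ _ refl))

  with+weak⇒blended : S with-r ≡ true → S weak-r ≡ true → DerivableRule S blended-r
  with+weak⇒blended e w ps _ (blended-i Γ Δ Σ A B) =
    perm (rule e (with-i (Γ ++ Δ ++ Σ) A B) (left ∷ right ∷ []))
         (solve 4 (λ Γ Δ Σ C → (Γ ⊕ (Δ ⊕ Σ)) ⊕ C ⊜ Γ ⊕ (Δ ⊕ (Σ ⊕ C))) refl Γ Δ Σ [ A ∧ B ])
    where
    left : Der S ps ((Γ ++ Δ ++ Σ) ++ [ A ])
    left = perm (weaken-by w Σ (++≢[] Γ (++≢[] Δ λ ())) (hyp (here refl)))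
                (solve 4 (λ Γ Δ Σ A → (Γ ⊕ (Δ ⊕ A)) ⊕ Σ ⊜ (Γ ⊕ (Δ ⊕ Σ)) ⊕ A) refl Γ Δ Σ [ A ])
    right : Der S ps ((Γ ++ Δ ++ Σ) ++ [ B ])
    right = perm (weaken-by w Δ (++≢[] Γ (++≢[] Σ λ ())) (hyp (there (here refl))))
                 (solve 4 (λ Γ Δ Σ B → (Γ ⊕ (Σ ⊕ B)) ⊕ Δ ⊜ (Γ ⊕ (Δ ⊕ Σ)) ⊕ B) refl Γ Δ Σ [ B ])

  tensor+contr⇒blended : S tensor-r ≡ true → S contr-r ≡ true → DerivableRule S blended-r
  tensor+contr⇒blended t c ps _ (blended-i Γ Δ Σ A B) =
    contract-copy c Γ
      (perm (rule t (tensor-i (Γ ++ Δ) (Γ ++ Σ) A B)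
                  (perm (hyp (here refl)) (reassoc Δ A) ∷ perm (hyp (there (here refl))) (reassoc Σ B) ∷ []))
            (solve 4 (λ Γ Δ Σ C → (Γ ⊕ Δ) ⊕ ((Γ ⊕ Σ) ⊕ C) ⊜ Γ ⊕ (Γ ⊕ (Δ ⊕ (Σ ⊕ C)))) refl Γ Δ Σ [ A ∧ B ]))
    where
    reassoc : ∀ Δ C → Γ ++ Δ ++ [ C ] ↭ (Γ ++ Δ) ++ [ C ]
    reassoc Δ C = ↭-reflexive (sym (++-assoc Γ Δ [ C ]))

-- Models

-- A sequent is valued by the product of the values of its formulas; Sound r says that r
-- preserves designated values.
record Model : Set₁ where
  infixl 7 _·_
  field
    Val Seqv    : Set
    ⟨_⟩         : Val → Seqv
    ε           : Seqv
    _·_         : Seqv → Seqv → Seqv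
    ·-assoc     : ∀ x y z → (x · y) · z ≡ x · (y · z)
    ·-comm      : ∀ x y → x · y ≡ y · x
    ·-identityˡ : ∀ x → ε · x ≡ x
    designated  : Seqv → Bool
    ~_          : Val → Val
    _⊓_ _⊔_     : Val → Val → Val

  D : Seqv → Set
  D = T ∘ designated

  Sound : Rule → Set
  Sound with-r    = ∀ γ a b → D (γ · ⟨ a ⟩) → D (γ · ⟨ b ⟩) → D (γ · ⟨ a ⊓ b ⟩)
  Sound tensor-r  = ∀ δ σ a b → D (δ · ⟨ a ⟩) → D (σ · ⟨ b ⟩) → D (δ · σ · ⟨ a ⊓ b ⟩)
  Sound blended-r = ∀ γ δ σ a b → D (γ · δ · ⟨ a ⟩) → D (γ · σ · ⟨ b ⟩) → D (γ · δ · σ · ⟨ a ⊓ b ⟩)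
  Sound plus-r    = (∀ γ a b → D (γ · ⟨ a ⟩) → D (γ · ⟨ a ⊔ b ⟩))
                  × (∀ γ a b → D (γ · ⟨ b ⟩) → D (γ · ⟨ a ⊔ b ⟩))
  Sound par-r     = ∀ γ a b → D (γ · ⟨ a ⟩ · ⟨ b ⟩) → D (γ · ⟨ a ⊔ b ⟩)
  Sound weak-r    = ∀ γ a → D γ → D (γ · ⟨ a ⟩)
  Sound contr-r   = ∀ γ a → D (γ · ⟨ a ⟩ · ⟨ a ⟩) → D (γ · ⟨ a ⟩)

  Models : System → Set
  Models S = (∀ a → D (⟨ a ⟩ · ⟨ ~ a ⟩)) × (∀ r → S r ≡ true → Sound r)

  ⟦_⟧ : Fm → (ℕ → Val) → Val
  ⟦ pos P ⟧ ρ = ρ P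
  ⟦ neg P ⟧ ρ = ~ ρ P
  ⟦ A ∧ B ⟧ ρ = ⟦ A ⟧ ρ ⊓ ⟦ B ⟧ ρ
  ⟦ A ∨ B ⟧ ρ = ⟦ A ⟧ ρ ⊔ ⟦ B ⟧ ρ

  ⟦_⟧ˢ : List Fm → (ℕ → Val) → Seqv
  ⟦ Γ ⟧ˢ ρ = foldr (λ A v → ⟨ ⟦ A ⟧ ρ ⟩ · v) ε Γ

  ·-identityʳ : ∀ x → x · ε ≡ x
  ·-identityʳ x = ≡-trans (·-comm x ε) (·-identityˡ x)

  along : ∀ {x y} → x ≡ y → D x → D y
  along = subst D

  module _ (ρ : ℕ → Val) where

    ⟦++⟧ : ∀ Γ Δ → ⟦ Γ ++ Δ ⟧ˢ ρ ≡ ⟦ Γ ⟧ˢ ρ · ⟦ Δ ⟧ˢ ρ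
    ⟦++⟧ []      Δ = sym (·-identityˡ _)
    ⟦++⟧ (A ∷ Γ) Δ = ≡-trans (cong (⟨ ⟦ A ⟧ ρ ⟩ ·_) (⟦++⟧ Γ Δ)) (sym (·-assoc _ _ _))

    ⟦∷ʳ⟧ : ∀ Γ A → ⟦ Γ ++ [ A ] ⟧ˢ ρ ≡ ⟦ Γ ⟧ˢ ρ · ⟨ ⟦ A ⟧ ρ ⟩
    ⟦∷ʳ⟧ Γ A = ≡-trans (⟦++⟧ Γ [ A ]) (cong (⟦ Γ ⟧ˢ ρ ·_) (·-identityʳ _))

    ⟦↭⟧ : ∀ {Γ Δ} → Γ ↭ Δ → ⟦ Γ ⟧ˢ ρ ≡ ⟦ Δ ⟧ˢ ρ
    ⟦↭⟧ refl         = refl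
    ⟦↭⟧ (prep A p)   = cong (⟨ ⟦ A ⟧ ρ ⟩ ·_) (⟦↭⟧ p)
    ⟦↭⟧ (swap A B p) = ≡-trans (cong (λ v → ⟨ ⟦ A ⟧ ρ ⟩ · (⟨ ⟦ B ⟧ ρ ⟩ · v)) (⟦↭⟧ p)) (swap-front _ _ _)
      where
      swap-front : ∀ x y z → x · (y · z) ≡ y · (x · z)
      swap-front x y z = ≡-trans (sym (·-assoc x y z)) (≡-trans (cong (_· z) (·-comm x y)) (·-assoc y x z))
    ⟦↭⟧ (trans p q)  = ≡-trans (⟦↭⟧ p) (⟦↭⟧ q)

    ⟦++∷ʳ⟧ : ∀ Γ Δ A → ⟦ Γ ++ Δ ++ [ A ] ⟧ˢ ρ ≡ ⟦ Γ ⟧ˢ ρ · ⟦ Δ ⟧ˢ ρ · ⟨ ⟦ A ⟧ ρ ⟩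
    ⟦++∷ʳ⟧ Γ Δ A = ≡-trans (cong (λ Λ → ⟦ Λ ⟧ˢ ρ) (sym (++-assoc Γ Δ [ A ])))
                           (≡-trans (⟦∷ʳ⟧ (Γ ++ Δ) A) (cong (_· ⟨ ⟦ A ⟧ ρ ⟩) (⟦++⟧ Γ Δ)))

    ⟦++∷ʳ⟧[_] : ∀ Γ A B → ⟦ Γ ++ A ∷ B ∷ [] ⟧ˢ ρ ≡ ⟦ Γ ⟧ˢ ρ · ⟨ ⟦ A ⟧ ρ ⟩ · ⟨ ⟦ B ⟧ ρ ⟩
    ⟦++∷ʳ⟧[ Γ ] A B = ≡-trans (⟦++∷ʳ⟧ Γ [ A ] B) (cong (λ v → ⟦ Γ ⟧ˢ ρ · v · ⟨ ⟦ B ⟧ ρ ⟩) (·-identityʳ _))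

    ⟦blended⟧ : ∀ Γ Δ Σ A → ⟦ Γ ++ Δ ++ Σ ++ [ A ] ⟧ˢ ρ ≡ ⟦ Γ ⟧ˢ ρ · ⟦ Δ ⟧ˢ ρ · ⟦ Σ ⟧ˢ ρ · ⟨ ⟦ A ⟧ ρ ⟩
    ⟦blended⟧ Γ Δ Σ A = ≡-trans (cong (λ Λ → ⟦ Λ ⟧ˢ ρ) (sym (++-assoc Γ Δ (Σ ++ [ A ]))))
                                (≡-trans (⟦++∷ʳ⟧ (Γ ++ Δ) Σ A) (cong (λ v → v · ⟦ Σ ⟧ˢ ρ · ⟨ ⟦ A ⟧ ρ ⟩) (⟦++⟧ Γ Δ)))

    inst-sound : ∀ {r ps c} → Sound r → Inst r ps c → All (λ Γ → D (⟦ Γ ⟧ˢ ρ)) ps → D (⟦ c ⟧ˢ ρ)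
    inst-sound s (with-i Γ A B) (d₁ ∷ d₂ ∷ []) =
      along (sym (⟦∷ʳ⟧ Γ (A ∧ B))) (s _ _ _ (along (⟦∷ʳ⟧ Γ A) d₁) (along (⟦∷ʳ⟧ Γ B) d₂))
    inst-sound s (tensor-i Δ Σ A B) (d₁ ∷ d₂ ∷ []) =
      along (sym (⟦++∷ʳ⟧ Δ Σ (A ∧ B))) (s _ _ _ _ (along (⟦∷ʳ⟧ Δ A) d₁) (along (⟦∷ʳ⟧ Σ B) d₂))
    inst-sound s (blended-i Γ Δ Σ A B) (d₁ ∷ d₂ ∷ []) =
      along (sym (⟦blended⟧ Γ Δ Σ (A ∧ B))) (s _ _ _ _ _ (along (⟦++∷ʳ⟧ Γ Δ A) d₁) (along (⟦++∷ʳ⟧ Γ Σ B) d₂))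
    inst-sound s (plus₁-i Γ A B) (d ∷ []) =
      along (sym (⟦∷ʳ⟧ Γ (A ∨ B))) (proj₁ s _ _ _ (along (⟦∷ʳ⟧ Γ A) d))
    inst-sound s (plus₂-i Γ A B) (d ∷ []) =
      along (sym (⟦∷ʳ⟧ Γ (A ∨ B))) (proj₂ s _ _ _ (along (⟦∷ʳ⟧ Γ B) d))
    inst-sound s (par-i Γ A B) (d ∷ []) =
      along (sym (⟦∷ʳ⟧ Γ (A ∨ B))) (s _ _ _ (along (⟦++∷ʳ⟧[ Γ ] A B) d))
    inst-sound s (weak-i Γ A _) (d ∷ []) = along (sym (⟦∷ʳ⟧ Γ A)) (s _ _ d)
    inst-sound s (contr-i Γ A) (d ∷ []) =
      along (sym (⟦∷ʳ⟧ Γ A)) (s _ _ (along (⟦++∷ʳ⟧[ Γ ] A A) d))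

  module _ {S : System} (models : Models S) where

    mutual
      sound : ∀ {Γ} → Der S [] Γ → ∀ ρ → D (⟦ Γ ⟧ˢ ρ)
      sound (ax P)               ρ = along (cong (⟨ ρ P ⟩ ·_) (sym (·-identityʳ _))) (proj₁ models (ρ P))
      sound (rule {r} e i ds)    ρ = inst-sound ρ (proj₂ models r e) i (sound-all ds ρ)
      sound (perm d p)           ρ = along (⟦↭⟧ ρ p) (sound d ρ)

      sound-all : ∀ {Γs} → All (Der S []) Γs → ∀ ρ → All (λ Γ → D (⟦ Γ ⟧ˢ ρ)) Γs
      sound-all []       ρ = []
      sound-all (d ∷ ds) ρ = sound d ρ ∷ sound-all ds ρ

    refutes⇒incomplete : ∀ A → Valid A → ∀ ρ → ¬ D (⟦ [ A ] ⟧ˢ ρ) → ¬ Complete S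
    refutes⇒incomplete A valid ρ ¬d complete = ¬d (sound (complete A valid) ρ)

record Finite (X : Set) : Set where
  field
    elements : List X
    complete : ∀ x → x ∈ elements

open Finite ⦃ ... ⦄

∀? : ∀ {X : Set} ⦃ _ : Finite X ⦄ {P : X → Set} → (∀ x → Dec (P x)) → Dec (∀ x → P x)
∀? P? = map′ (λ all x → All.lookup all (complete x)) (λ h → All.tabulate λ {x} _ → h x) (All.all? P? elements)

instance
  finite-Bool : Finite Bool
  finite-Bool = record
    { elements = true ∷ false ∷ [] ; complete = λ { true → here refl ; false → there (here refl) } }

  finite-⊤ : Finite ⊤
  finite-⊤ = record { elements = [ tt ] ; complete = λ _ → here refl }

  finite-Fin : ∀ {n} → Finite (Fin n)
  finite-Fin {n} = record { elements = allFin n ; complete = ∈-allFin }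

  finite-× : ∀ {X Y} ⦃ _ : Finite X ⦄ ⦃ _ : Finite Y ⦄ → Finite (X × Y)
  finite-× = record
    { elements = cartesianProduct elements elements
    ; complete = λ (x , y) → ∈-cartesianProduct⁺ (complete x) (complete y) }

  finite-Rule : Finite Rule
  finite-Rule = record
    { elements = with-r ∷ tensor-r ∷ blended-r ∷ plus-r ∷ par-r ∷ weak-r ∷ contr-r ∷ []
    ; complete = λ { with-r → here refl ; tensor-r → there (here refl) ; blended-r → there (there (here refl))
                   ; plus-r → there (there (there (here refl))) ; par-r → there (there (there (there (here refl))))
                   ; weak-r → there (there (there (there (there (here refl)))))
                   ; contr-r → there (there (there (there (there (there (here refl)))))) } }

module Decide (M : Model) ⦃ _ : Finite (Model.Val M) ⦄ ⦃ _ : Finite (Model.Seqv M) ⦄ where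
  open Model M

  D? : ∀ v → Dec (D v)
  D? = T? ∘ designated

  sound? : ∀ r → Dec (Sound r)
  sound? with-r    = ∀? λ γ → ∀? λ a → ∀? λ b → D? _ →-dec D? _ →-dec D? _
  sound? tensor-r  = ∀? λ δ → ∀? λ σ → ∀? λ a → ∀? λ b → D? _ →-dec D? _ →-dec D? _
  sound? blended-r = ∀? λ γ → ∀? λ δ → ∀? λ σ → ∀? λ a → ∀? λ b → D? _ →-dec D? _ →-dec D? _
  sound? plus-r    = (∀? λ γ → ∀? λ a → ∀? λ b → D? _ →-dec D? _)
                  ×-dec (∀? λ γ → ∀? λ a → ∀? λ b → D? _ →-dec D? _)
  sound? par-r     = ∀? λ γ → ∀? λ a → ∀? λ b → D? _ →-dec D? _
  sound? weak-r    = ∀? λ γ → ∀? λ a → D? _ →-dec D? _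
  sound? contr-r   = ∀? λ γ → ∀? λ a → D? _ →-dec D? _

  models? : ∀ S → Dec (Models S)
  models? S = (∀? λ a → D? _) ×-dec (∀? λ r → (S r ≟ᵇ true) →-dec sound? r)

module MonoidLaws {X : Set} ⦃ _ : Finite X ⦄ (_≟_ : DecidableEquality X) (_·_ : X → X → X) (ε : X) where

  assoc? : Dec (∀ x y z → (x · y) · z ≡ x · (y · z))
  assoc? = ∀? λ x → ∀? λ y → ∀? λ z → _ ≟ _

  comm? : Dec (∀ x y → x · y ≡ y · x)
  comm? = ∀? λ x → ∀? λ y → _ ≟ _

  identityˡ? : Dec (∀ x → ε · x ≡ x)
  identityˡ? = ∀? λ x → _ ≟ _

-- Countermodels

rule-index : Rule → ℕ
rule-index with-r    = 0
rule-index tensor-r  = 1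
rule-index blended-r = 2
rule-index plus-r    = 3
rule-index par-r     = 4
rule-index weak-r    = 5
rule-index contr-r   = 6

index-rule : ℕ → Rule
index-rule 0 = with-r
index-rule 1 = tensor-r
index-rule 2 = blended-r
index-rule 3 = plus-r
index-rule 4 = par-r
index-rule 5 = weak-r
index-rule _ = contr-r

index-rule∘rule-index : ∀ r → index-rule (rule-index r) ≡ r
index-rule∘rule-index with-r    = refl
index-rule∘rule-index tensor-r  = refl
index-rule∘rule-index blended-r = refl
index-rule∘rule-index plus-r    = refl
index-rule∘rule-index par-r     = refl
index-rule∘rule-index weak-r    = refl
index-rule∘rule-index contr-r   = refl

_≟ᴿ_ : DecidableEquality Rule
r ≟ᴿ s = map′ injective (cong rule-index) (rule-index r ≟ rule-index s)
  where
  injective : rule-index r ≡ rule-index s → r ≡ s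
  injective e = ≡-trans (sym (index-rule∘rule-index r)) (≡-trans (cong index-rule e) (index-rule∘rule-index s))

_⊆ˢ_ : System → System → Set
S ⊆ˢ S′ = ∀ r → S r ≡ true → S′ r ≡ true

all-but : Rule → Rule → System
all-but x y r = not (isYes (r ≟ᴿ blended-r) or isYes (r ≟ᴿ x) or isYes (r ≟ᴿ y))

⊆-all-but : ∀ {S x y} → Standard S → S x ≡ false → S y ≡ false → S ⊆ˢ all-but x y
⊆-all-but {S} {x} {y} std ¬x ¬y r Sr with r ≟ᴿ blended-r | r ≟ᴿ x | r ≟ᴿ y
... | yes refl | _        | _        = case ≡-trans (sym Sr) std of λ ()
... | no _     | yes refl | _        = case ≡-trans (sym Sr) ¬x of λ ()
... | no _     | no _     | yes refl = case ≡-trans (sym Sr) ¬y of λ ()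
... | no _     | no _     | no _     = refl

record Countermodel (x y : Rule) : Set₁ where
  field
    model : Model
  open Model model public
  field
    models    : Models (all-but x y)
    formula   : Fm
    valid     : Valid formula
    valuation : ℕ → Val
    refuted   : ¬ D (⟦ [ formula ] ⟧ˢ valuation)

countermodel⇒incomplete : ∀ {x y S} → Countermodel x y → Standard S → S x ≡ false → S y ≡ false → ¬ Complete S
countermodel⇒incomplete cm std ¬x ¬y =
  refutes⇒incomplete (proj₁ models , λ r Sr → proj₂ models r (⊆-all-but std ¬x ¬y r Sr))
                     formula valid valuation refuted
  where open Countermodel cm

boolean : (Bool → Bool → Bool) → (Bool → Bool → Bool) → Model
boolean _⊓_ _⊔_ = record
  { Val = Bool ; Seqv = Bool ; ⟨_⟩ = id ; ε = false ; _·_ = _or_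
  ; ·-assoc = ∨-assoc ; ·-comm = ∨-comm ; ·-identityˡ = ∨-identityˡ
  ; designated = id ; ~_ = not ; _⊓_ = _⊓_ ; _⊔_ = _⊔_ }

excluded-middle : Fm
excluded-middle = pos 0 ∨ neg 0

excluded-middle-valid : Valid excluded-middle
excluded-middle-valid v with v 0
... | true  = refl
... | false = refl

without-plus-par : Countermodel plus-r par-r
without-plus-par = record
  { model = M ; models = from-yes (Decide.models? M (all-but plus-r par-r))
  ; formula = excluded-middle ; valid = excluded-middle-valid ; valuation = λ _ → true ; refuted = λ () }
  where
  M : Model
  M = boolean _and_ (λ _ _ → false)

without-with-tensor : Countermodel with-r tensor-r
without-with-tensor = record
  { model = M ; models = from-yes (Decide.models? M (all-but with-r tensor-r))
  ; formula = (pos 0 ∧ pos 0) ∨ neg 0 ; valid = valid ; valuation = λ _ → true ; refuted = λ () }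
  where
  M : Model
  M = boolean (λ _ _ → false) _or_
  valid : Valid ((pos 0 ∧ pos 0) ∨ neg 0)
  valid v with v 0
  ... | true  = refl
  ... | false = refl

-- The polarities of one variable occurring in a sequent; balanced sequents are designated.
Polarity : Set
Polarity = Bool × Bool

_≟ₚ_ : DecidableEquality Polarity
_≟ₚ_ = ≡-dec _≟ᵇ_ _≟ᵇ_

_∪_ : Polarity → Polarity → Polarity
(p , n) ∪ (p′ , n′) = p or p′ , n or n′

opposite : Polarity → Polarity
opposite (p , n) = n , p

polarity : (Polarity → Polarity → Polarity) → (Polarity → Polarity → Polarity) → Model
polarity _⊓_ _⊔_ = record
  { Val = Polarity ; Seqv = Polarity ; ⟨_⟩ = id ; ε = false , false ; _·_ = _∪_
  ; ·-assoc = from-yes assoc? ; ·-comm = from-yes comm? ; ·-identityˡ = from-yes identityˡ?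
  ; designated = λ (p , n) → isYes (p ≟ᵇ n) ; ~_ = opposite ; _⊓_ = _⊓_ ; _⊔_ = _⊔_ }
  where open MonoidLaws _≟ₚ_ _∪_ (false , false)

only-second : ℕ → Polarity
only-second 1 = true , false
only-second _ = false , false

without-plus-weak : Countermodel plus-r weak-r
without-plus-weak = record
  { model = M ; models = from-yes (Decide.models? M (all-but plus-r weak-r))
  ; formula = (pos 0 ∨ neg 0) ∨ pos 1 ; valid = valid ; valuation = only-second ; refuted = λ () }
  where
  M : Model
  M = polarity _∪_ _∪_
  valid : Valid ((pos 0 ∨ neg 0) ∨ pos 1)
  valid v with v 0
  ... | true  = refl
  ... | false = refl

-- For a ≠ b the & rule only constrains a ⊓ b when a ∪ b has both polarities, and then
-- opposite (a ∪ b) = a ∪ b; elsewhere the polarity is flipped, which refutes the formula below.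
without-tensor-weak : Countermodel tensor-r weak-r
without-tensor-weak = record
  { model = M ; models = from-yes (Decide.models? M (all-but tensor-r weak-r))
  ; formula = ((pos 0 ∧ pos 1) ∨ (neg 0 ∧ pos 1)) ∨ neg 1 ; valid = valid
  ; valuation = only-second ; refuted = λ () }
  where
  M : Model
  M = polarity (λ a b → if isYes (a ≟ₚ b) then a else opposite (a ∪ b))
               (λ a b → if isYes (a ≟ₚ b) then a else (true , true))
  valid : Valid (((pos 0 ∧ pos 1) ∨ (neg 0 ∧ pos 1)) ∨ neg 1)
  valid v with v 0 | v 1
  ... | true  | true  = refl
  ... | true  | false = refl
  ... | false | true  = refl
  ... | false | false = refl

pattern 𝟘 = zero
pattern 𝟙 = suc zero
pattern 𝟚 = suc (suc zero)

_⊕₃_ : Fin 3 → Fin 3 → Fin 3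
𝟘 ⊕₃ b = b
𝟙 ⊕₃ 𝟘 = 𝟙
𝟙 ⊕₃ _ = 𝟚
𝟚 ⊕₃ _ = 𝟚

is-𝟚 : Fin 3 → Bool
is-𝟚 a = isYes (a ≟ᶠ 𝟚)

-- A sequent is valued by its number of formulas, capped at 2.
without-par-contr : Countermodel par-r contr-r
without-par-contr = record
  { model = M ; models = from-yes (Decide.models? M (all-but par-r contr-r))
  ; formula = excluded-middle ; valid = excluded-middle-valid ; valuation = λ _ → tt ; refuted = λ () }
  where
  open MonoidLaws _≟ᶠ_ _⊕₃_ 𝟘
  M : Model
  M = record
    { Val = ⊤ ; Seqv = Fin 3 ; ⟨_⟩ = λ _ → 𝟙 ; ε = 𝟘 ; _·_ = _⊕₃_
    ; ·-assoc = from-yes assoc? ; ·-comm = from-yes comm? ; ·-identityˡ = from-yes identityˡ?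
    ; designated = is-𝟚 ; ~_ = id ; _⊓_ = λ _ _ → tt ; _⊔_ = λ _ _ → tt }

-- Three-valued Łukasiewicz logic, with values 0, 1/2, 1 written 𝟘, 𝟙, 𝟚.
without-with-contr : Countermodel with-r contr-r
without-with-contr = record
  { model = M ; models = from-yes (Decide.models? M (all-but with-r contr-r))
  ; formula = (pos 0 ∧ pos 0) ∨ neg 0 ; valid = valid ; valuation = λ _ → 𝟙 ; refuted = λ () }
  where
  open MonoidLaws _≟ᶠ_ _⊕₃_ 𝟘
  ~₃_ : Fin 3 → Fin 3
  ~₃ 𝟘 = 𝟚
  ~₃ 𝟙 = 𝟙
  ~₃ 𝟚 = 𝟘
  M : Model
  M = record
    { Val = Fin 3 ; Seqv = Fin 3 ; ⟨_⟩ = id ; ε = 𝟘 ; _·_ = _⊕₃_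
    ; ·-assoc = from-yes assoc? ; ·-comm = from-yes comm? ; ·-identityˡ = from-yes identityˡ?
    ; designated = is-𝟚 ; ~_ = ~₃_ ; _⊓_ = λ a b → ~₃ ((~₃ a) ⊕₃ (~₃ b)) ; _⊔_ = _⊕₃_ }
  valid : Valid ((pos 0 ∧ pos 0) ∨ neg 0)
  valid v with v 0
  ... | true  = refl
  ... | false = refl

module _ {K : Set} (_≟ₖ_ : DecidableEquality K) where

  lookup-or-0 : List (K × ℕ) → K → ℕ
  lookup-or-0 []            k = 0
  lookup-or-0 ((k′ , v) ∷ t) k with k ≟ₖ k′
  ... | yes _ = v
  ... | no _  = lookup-or-0 t k

  lookup-or-0-cases : ∀ t k → lookup-or-0 t k ≡ 0 ⊎ (k , lookup-or-0 t k) ∈ t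
  lookup-or-0-cases []             k = inj₁ refl
  lookup-or-0-cases ((k′ , v) ∷ t) k with k ≟ₖ k′
  ... | yes refl = inj₂ (here refl)
  ... | no _ with lookup-or-0-cases t k
  ...   | inj₁ e = inj₁ e
  ...   | inj₂ m = inj₂ (there m)

-- A sequent of subformulas of ((P ∧ Q) ∧ P ∨ ¬Q) ∨ ¬P is coded by the product of the primes
-- of its members: (P ∧ Q) ∧ P ↦ 2, P ∧ Q ↦ 3, ¬P ↦ 5, ¬Q ↦ 7, (P ∧ Q) ∧ P ∨ ¬Q ↦ 11, the whole ↦ 13,
-- P ↦ 17, Q ↦ 19; every other formula has code 0, which is designated.
module PrimeCodes where

  -- 0 and the codes of the 50 such sequents derivable with &, ⊗, ⊕ and par (a finite closure).
  derivable-codes : List ℕ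
  derivable-codes =
    0 ∷ 26 ∷ 39 ∷ 65 ∷ 85 ∷ 105 ∷ 130 ∷ 133 ∷ 143 ∷ 165 ∷ 169 ∷ 195 ∷ 209 ∷ 221 ∷ 247 ∷ 273 ∷ 275 ∷
    325 ∷ 338 ∷ 350 ∷ 429 ∷ 455 ∷ 507 ∷ 550 ∷ 650 ∷ 715 ∷ 845 ∷ 910 ∷ 1183 ∷ 1430 ∷ 1690 ∷ 1859 ∷
    1925 ∷ 2197 ∷ 2275 ∷ 2366 ∷ 3025 ∷ 3575 ∷ 3718 ∷ 4225 ∷ 4394 ∷ 5005 ∷ 5915 ∷ 7865 ∷ 9295 ∷
    10985 ∷ 13013 ∷ 15379 ∷ 20449 ∷ 24167 ∷ 28561 ∷ []

  D₇ : ℕ → Set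
  D₇ v = True (v ∈? derivable-codes)

  D₇? : ∀ v → Dec (D₇ v)
  D₇? v = T? (isYes (v ∈? derivable-codes))

  D₇-junk : ∀ γ {c} → c ≡ 0 → D₇ (γ * c)
  D₇-junk γ refl = subst D₇ (sym (*-zeroʳ γ)) _

  quotients : ∀ a .{{_ : NonZero a}} → List ℕ
  quotients a = map (_/ a) (filter (a ∣?_) derivable-codes)

  ∈-quotients : ∀ a .{{_ : NonZero a}} γ → D₇ (γ * a) → γ ∈ quotients a
  ∈-quotients a γ d =
    subst (_∈ quotients a) (m*n/n≡m γ a) (∈-map⁺ (_/ a) (∈-filter⁺ (a ∣?_) (toWitness d) (n∣m*n γ)))

  by-quotients : ∀ a .{{_ : NonZero a}} {P : ℕ → Set} (P? : ∀ γ → Dec (P γ)) →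
                 {True (All.all? P? (quotients a))} → ∀ γ → D₇ (γ * a) → P γ
  by-quotients a P? {ok} γ d = All.lookup (toWitness ok) (∈-quotients a γ d)

  ρ₇ : ℕ → ℕ
  ρ₇ 0 = 17
  ρ₇ 1 = 19
  ρ₇ _ = 0

  ~-table : List (ℕ × ℕ)
  ~-table = (17 , 5) ∷ (19 , 7) ∷ []

  ⊓-table ⊔-table : List ((ℕ × ℕ) × ℕ)
  ⊓-table = ((17 , 19) , 3) ∷ ((3 , 17) , 2) ∷ []
  ⊔-table = ((2 , 7) , 11) ∷ ((11 , 5) , 13) ∷ []

  _≟²_ : DecidableEquality (ℕ × ℕ)
  _≟²_ = ≡-dec _≟_ _≟_

  ~₇_ : ℕ → ℕ
  ~₇ a = lookup-or-0 _≟_ ~-table a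

  _⊓₇_ _⊔₇_ : ℕ → ℕ → ℕ
  a ⊓₇ b = lookup-or-0 _≟²_ ⊓-table (a , b)
  a ⊔₇ b = lookup-or-0 _≟²_ ⊔-table (a , b)

  M₇ : Model
  M₇ = record
    { Val = ℕ ; Seqv = ℕ ; ⟨_⟩ = id ; ε = 1 ; _·_ = _*_
    ; ·-assoc = *-assoc ; ·-comm = *-comm ; ·-identityˡ = *-identityˡ
    ; designated = λ v → isYes (v ∈? derivable-codes)
    ; ~_ = ~₇_ ; _⊓_ = _⊓₇_ ; _⊔_ = _⊔₇_ }

  axiom₇ : ∀ a → D₇ (a * ~₇ a)
  axiom₇ a with ~₇ a | lookup-or-0-cases _≟_ ~-table a
  ... | _ | inj₁ junk                = D₇-junk a junk
  ... | _ | inj₂ (here refl)         = _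
  ... | _ | inj₂ (there (here refl)) = _

  with₇ : ∀ γ a b → D₇ (γ * a) → D₇ (γ * b) → D₇ (γ * (a ⊓₇ b))
  with₇ γ a b with a ⊓₇ b | lookup-or-0-cases _≟²_ ⊓-table (a , b)
  ... | _ | inj₁ junk                = λ _ _ → D₇-junk γ junk
  ... | _ | inj₂ (here refl)         = by-quotients 17 (λ γ → D₇? (γ * 19) →-dec D₇? (γ * 3)) γ
  ... | _ | inj₂ (there (here refl)) = by-quotients 3 (λ γ → D₇? (γ * 17) →-dec D₇? (γ * 2)) γ

  tensor₇ : ∀ δ σ a b → D₇ (δ * a) → D₇ (σ * b) → D₇ (δ * σ * (a ⊓₇ b))
  tensor₇ δ σ a b with a ⊓₇ b | lookup-or-0-cases _≟²_ ⊓-table (a , b)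
  ... | _ | inj₁ junk                = λ _ _ → D₇-junk (δ * σ) junk
  ... | _ | inj₂ (here refl)         = λ dδ dσ →
    All.lookup (by-quotients 17 (λ δ → All.all? (λ σ → D₇? (δ * σ * 3)) (quotients 19)) δ dδ) (∈-quotients 19 σ dσ)
  ... | _ | inj₂ (there (here refl)) = λ dδ dσ →
    All.lookup (by-quotients 3 (λ δ → All.all? (λ σ → D₇? (δ * σ * 2)) (quotients 17)) δ dδ) (∈-quotients 17 σ dσ)

  plus₇ˡ : ∀ γ a b → D₇ (γ * a) → D₇ (γ * (a ⊔₇ b))
  plus₇ˡ γ a b with a ⊔₇ b | lookup-or-0-cases _≟²_ ⊔-table (a , b)
  ... | _ | inj₁ junk                = λ _ → D₇-junk γ junk
  ... | _ | inj₂ (here refl)         = by-quotients 2 (λ γ → D₇? (γ * 11)) γ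
  ... | _ | inj₂ (there (here refl)) = by-quotients 11 (λ γ → D₇? (γ * 13)) γ

  plus₇ʳ : ∀ γ a b → D₇ (γ * b) → D₇ (γ * (a ⊔₇ b))
  plus₇ʳ γ a b with a ⊔₇ b | lookup-or-0-cases _≟²_ ⊔-table (a , b)
  ... | _ | inj₁ junk                = λ _ → D₇-junk γ junk
  ... | _ | inj₂ (here refl)         = by-quotients 7 (λ γ → D₇? (γ * 11)) γ
  ... | _ | inj₂ (there (here refl)) = by-quotients 5 (λ γ → D₇? (γ * 13)) γ

  par₇ : ∀ γ a b → D₇ (γ * a * b) → D₇ (γ * (a ⊔₇ b))
  par₇ γ a b with a ⊔₇ b | lookup-or-0-cases _≟²_ ⊔-table (a , b)
  ... | _ | inj₁ junk                = λ _ → D₇-junk γ junk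
  ... | _ | inj₂ (here refl)         = by-quotients 14 (λ γ → D₇? (γ * 11)) γ ∘ subst D₇ (*-assoc γ 2 7)
  ... | _ | inj₂ (there (here refl)) = by-quotients 55 (λ γ → D₇? (γ * 13)) γ ∘ subst D₇ (*-assoc γ 11 5)

without-weak-contr : Countermodel weak-r contr-r
without-weak-contr = record
  { model = M₇ ; models = axiom₇ , sound
  ; formula = ((pos 0 ∧ pos 1) ∧ pos 0 ∨ neg 1) ∨ neg 0 ; valid = valid ; valuation = ρ₇ ; refuted = λ () }
  where
  open PrimeCodes
  open Model M₇ using (Sound)
  sound : ∀ r → all-but weak-r contr-r r ≡ true → Sound r
  sound with-r    _ = with₇
  sound tensor-r  _ = tensor₇
  sound plus-r    _ = plus₇ˡ , plus₇ʳ
  sound par-r     _ = par₇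
  sound blended-r ()
  sound weak-r    ()
  sound contr-r   ()
  valid : Valid (((pos 0 ∧ pos 1) ∧ pos 0 ∨ neg 1) ∨ neg 0)
  valid v with v 0 | v 1
  ... | true  | true  = refl
  ... | true  | false = refl
  ... | false | true  = refl
  ... | false | false = refl

module _ {S : System} (std : Standard S) (complete : Complete S) where

  private
    refuted-by : ∀ {x y} {A : Set} → Countermodel x y → S x ≡ false → S y ≡ false → A
    refuted-by cm ¬x ¬y = ⊥-elim (countermodel⇒incomplete cm std ¬x ¬y complete)

  plus-derivable : DerivableRule S plus-r
  plus-derivable with S plus-r in plus | S par-r in par | S weak-r in weak
  ... | true  | _     | _     = rule⇒derivable plus
  ... | false | false | _     = refuted-by without-plus-par plus par
  ... | false | true  | true  = par+weak⇒plus par weak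
  ... | false | true  | false = refuted-by without-plus-weak plus weak

  par-derivable : DerivableRule S par-r
  par-derivable with S par-r in par | S plus-r in plus | S contr-r in contr
  ... | true  | _     | _     = rule⇒derivable par
  ... | false | false | _     = refuted-by without-plus-par plus par
  ... | false | true  | true  = plus+contr⇒par plus contr
  ... | false | true  | false = refuted-by without-par-contr par contr

  blended-derivable : DerivableRule S blended-r
  blended-derivable with S with-r in with′ | S weak-r in weak | S tensor-r in tensor | S contr-r in contr
  ... | true  | true  | _     | _     = with+weak⇒blended with′ weak
  ... | _     | _     | true  | true  = tensor+contr⇒blended tensor contr
  ... | false | _     | false | _     = refuted-by without-with-tensor with′ tensor
  ... | false | _     | true  | false = refuted-by without-with-contr with′ contr
  ... | true  | false | false | _     = refuted-by without-tensor-weak tensor weak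
  ... | true  | false | true  | false = refuted-by without-weak-contr weak contr

complete⇒contains-Mp : ∀ {S} → Standard S → Complete S → Contains S Mp
complete⇒contains-Mp std complete blended-r _ = blended-derivable std complete
complete⇒contains-Mp std complete plus-r    _ = plus-derivable std complete
complete⇒contains-Mp std complete par-r     _ = par-derivable std complete

theorem9 : (S : System) → Standard S → (Complete S → Contains S Mp) × (Contains S Mp → Complete S)
theorem9 S std = complete⇒contains-Mp std , λ S⊇Mp → Contains⇒Complete S⊇Mp Mp-complete
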